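{- Let $s\geq 2$, $k=2^s-1$, and let $F$ be a caterpillar with $k$ edges of one of the following forms: (a) $CP_{(1,t,1)}$ with $t\geq 2$; (b) $CP_{(t,q)}$ with $t,q\geq 2$ odd; (c) $CP_{(t,0,q)}$ with $t,q\geq 2$; (d) $CP_{(t,0,0,q)}$ with $t,q\geq 2$; (e) $CP_{(t,1,q)}$ with $t,q\geq 2$ odd. Then $ex^*(n,F)\geq \frac{k}{2}n+O(1)$ as $n\to\infty$.
   Context: The caterpillar $CP_{(s_1,\dots,s_t)}$ is the tree consisting of a central path with $t$ vertices $v_1,\dots,v_t$ (in order) together with $s_i$ pendant leaves attached to $v_i$ for each $i$. An edge coloring is proper if edges sharing a vertex get different colors; a subgraph is rainbow if all its edges have distinct colors. $ex^*(n,F)$ is the maximum number of edges in a properly edge-colored $n$-vertex graph with no rainbow copy of $F$. -}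

module Defs where

open import Data.Nat using (ℕ; zero; suc; _+_; _*_; _∸_; _^_; _≤_)
open import Data.Fin using (Fin; toℕ; _<?_)
open import Data.Bool using (Bool; true; false; if_then_else_)
open import Data.Nat.ListAction using (sum)
open import Data.List using (List; []; _∷_; map; length; allFin; concatMap; _++_; lookup)
open import Data.Product using (_×_; _,_; ∃; Σ)
open import Data.List.Membership.Propositional using (_∈_)
open import Data.List.Relation.Unary.Unique.Propositional using (Unique)
open import Relation.Binary.PropositionalEquality using (_≡_; _≢_)
open import Relation.Nullary.Decidable using (⌊_⌋)
open import Data.Bool using (_∧_)

-- Host graphs: simple graphs on vertex set Fin n, given by a symmetric,
-- irreflexive Boolean adjacency matrix, together with an edge colouring
-- (colours are natural numbers; only colours of actual edges matter).

record ColoredGraph (n : ℕ) : Set where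
  field
    adj    : Fin n → Fin n → Bool
    sym    : ∀ u v → adj u v ≡ adj v u
    irrefl : ∀ u → adj u u ≡ false
    col    : Fin n → Fin n → ℕ
    colSym : ∀ u v → col u v ≡ col v u

open ColoredGraph public

edgeCount : ∀ {n} → ColoredGraph n → ℕ
edgeCount {n} G =
  sum (concatMap (λ u → map (λ v → if ⌊ u <? v ⌋ ∧ adj G u v then 1 else 0) (allFin n)) (allFin n))

Proper : ∀ {n} → ColoredGraph n → Set
Proper {n} G = ∀ (u v w : Fin n) → adj G u v ≡ true → adj G u w ≡ true → v ≢ w →
               col G u v ≢ col G u w

record PatternGraph : Set₁ where
  field
    Vtx   : Set
    edges : List (Vtx × Vtx)

open PatternGraph public

RainbowCopy : ∀ {n} → PatternGraph → ColoredGraph n → Set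
RainbowCopy {n} F G =
  Σ (Vtx F → Fin n) λ φ →
    (∀ a b → φ a ≡ φ b → a ≡ b) ×
    (∀ {a b} → (a , b) ∈ edges F → adj G (φ a) (φ b) ≡ true) ×
    Unique (map (λ e → col G (φ (Data.Product.proj₁ e)) (φ (Data.Product.proj₂ e))) (edges F))

-- Caterpillars CP_(s_1,...,s_t): spine v_1..v_t and s_i leaves at v_i.

data CPVtx (s : List ℕ) : Set where
  spine : Fin (length s) → CPVtx s
  leaf  : (i : Fin (length s)) → Fin (lookup s i) → CPVtx s

pathEdges : (t : ℕ) → List (Fin t × Fin t)
pathEdges zero = []
pathEdges (suc zero) = []
pathEdges (suc (suc t)) =
  (Data.Fin.zero , Data.Fin.suc Data.Fin.zero) ∷ map (λ e → Data.Fin.suc (Data.Product.proj₁ e) , Data.Fin.suc (Data.Product.proj₂ e)) (pathEdges (suc t))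

CP : List ℕ → PatternGraph
CP s = record
  { Vtx   = CPVtx s
  ; edges = map (λ e → spine (Data.Product.proj₁ e) , spine (Data.Product.proj₂ e)) (pathEdges (length s))
            ++ concatMap (λ i → map (λ j → spine i , leaf i j) (allFin (lookup s i))) (allFin (length s))
  }

Odd : ℕ → Set
Odd n = ∃ λ m → n ≡ suc (2 * m)

data Shape : List ℕ → Set where
  shape-a : ∀ t → 2 ≤ t → Shape (1 ∷ t ∷ 1 ∷ [])
  shape-b : ∀ t q → 2 ≤ t → 2 ≤ q → Odd t → Odd q → Shape (t ∷ q ∷ [])
  shape-c : ∀ t q → 2 ≤ t → 2 ≤ q → Shape (t ∷ 0 ∷ q ∷ [])
  shape-d : ∀ t q → 2 ≤ t → 2 ≤ q → Shape (t ∷ 0 ∷ 0 ∷ q ∷ [])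
  shape-e : ∀ t q → 2 ≤ t → 2 ≤ q → Odd t → Odd q → Shape (t ∷ 1 ∷ q ∷ [])

module Submission where

-- Cut {0, …, n-1} into blocks of m = 2^s consecutive numbers, make every complete
-- block a clique and leave the incomplete last block empty.  Label a vertex by the word in
-- (ℤ/2)^s given by its s lowest binary digits and colour the edge xy by the word label x ⊕ label y
-- (coded as a number).  The colouring is proper, and each complete block contributes m(m-1)/2
-- edges, which gives (m-1) n ≤ 2 e(G) + (m-1) m.
--
-- A rainbow copy of a connected F with k edges lies inside one block and uses
-- 2^s vertices there, so its vertex labels are all words and its edge colours are all nonzero words.
-- For s ≥ 2 the words of (ℤ/2)^s sum to 0.  Orienting every edge of the caterpillar away from the
-- first spine vertex v₁, every other vertex is the head of exactly one edge; comparing the sum of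
-- all colours with the sum of all labels gives  Σ_{edges uv} label u = label v₁.  For each of the
-- five shapes, together with the parity of |E(F)| = k, this linear relation forces two spine
-- vertices to share a label, or (shape d) two edges of F to share a colour.

open import Defs hiding (sym)
open import Data.Nat using (ℕ; zero; suc; _+_; _*_; _∸_; _^_; _≤_; _<_; z≤n; s≤s; s≤s⁻¹; NonZero; _/_; _%_; _≟_; _<?_)
open import Data.Nat.Properties
open import Data.Nat.DivMod
  using (m≡m%n+[m/n]*n; m/n/o≡m/[n*o]; n/1≡n; m%n<n; m/n*n≤m; m*n/n≡m; m<n⇒m/n≡0; +-distrib-/-∣ˡ; /-monoˡ-≤; m<n*o⇒m/o<n)
open import Data.Nat.Divisibility using (n∣m*n)
open import Data.Nat.ListAction using (sum)
open import Data.Nat.ListAction.Properties using (sum-++)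
open import Data.Nat.Tactic.RingSolver using (solve-∀)
open import Data.Bool using (Bool; true; false; not; _xor_; _∧_; if_then_else_)
open import Data.Bool.Properties using (xor-same; xor-assoc; xor-comm; xor-identityˡ; xor-identityʳ; not-injective)
open import Data.Vec using (Vec; []; _∷_; zipWith; replicate)
open import Data.Vec.Properties using (zipWith-assoc; zipWith-comm; zipWith-identityˡ; zipWith-identityʳ; ∷-injective)
open import Data.List using (List; []; _∷_; _++_; map; foldr; length; concat; concatMap; allFin; lookup; tabulate)
open import Data.List.Properties using (length-++; length-map; length-tabulate; map-++; map-∘; map-cong; map-tabulate; concat-map)
open import Data.List.Membership.Propositional using (_∈_; _∉_)
open import Data.List.Membership.Propositional.Properties
  using (∈-∃++; ∈-++⁻; ∈-++⁺ˡ; ∈-++⁺ʳ; ∈-map⁺; ∈-map⁻; ∈-allFin; ∈-concat⁺′; ∈-concat⁻′)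
open import Data.List.Relation.Unary.Any using (here; there)
import Data.List.Relation.Unary.All as All
open import Data.List.Relation.Unary.All using (_∷_)
import Data.List.Relation.Unary.All.Properties as AllProperties
open import Data.List.Relation.Unary.AllPairs using (_∷_)
import Data.List.Relation.Unary.AllPairs as AllPairs
import Data.List.Relation.Unary.AllPairs.Properties as AllPairsProperties
open import Data.List.Relation.Unary.Unique.Propositional using (Unique)
import Data.List.Relation.Unary.Unique.Propositional.Properties as Unique
open import Data.List.Relation.Binary.Disjoint.Propositional using (Disjoint)
open import Data.List.Relation.Binary.Permutation.Propositional using (_↭_; prep; ↭-refl; ↭-trans; ↭-sym; ↭⇒↭ₛ)
open import Data.List.Relation.Binary.Permutation.Propositional.Properties using (shift)
open import Data.List.Relation.Binary.Permutation.Setoid.Properties using (foldr-commMonoid)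
open import Data.Fin using (Fin; toℕ) renaming (zero to 0F; suc to sucF)
open import Data.Fin.Properties using (toℕ-injective)
open import Data.Product using (_×_; _,_; proj₁; proj₂; ∃)
open import Data.Sum using (inj₁; inj₂)
open import Data.Empty using (⊥; ⊥-elim)
open import Function using (_∘_)
open import Function.Bundles using (mk⇔)
open import Relation.Nullary using (¬_; Dec; yes; no; does; ¬?; _×-dec_; ⌊_⌋)
open import Relation.Nullary.Decidable using (does-⇔; dec-false; isYes≗does)
open import Relation.Binary.PropositionalEquality
open import Algebra.Structures using (IsAbelianGroup)
open import Algebra.Bundles using (AbelianGroup)
import Algebra.Properties.Group as GroupProperties
import Algebra.Properties.CommutativeSemigroup as CommutativeSemigroupProperties

isOdd : ℕ → Bool
isOdd 0 = false
isOdd 1 = true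
isOdd (suc (suc n)) = isOdd n

isOdd-suc : ∀ n → isOdd (suc n) ≡ not (isOdd n)
isOdd-suc 0 = refl
isOdd-suc 1 = refl
isOdd-suc (suc (suc n)) = isOdd-suc n

isOdd-+ : ∀ m n → isOdd (m + n) ≡ isOdd m xor isOdd n
isOdd-+ 0 n = refl
isOdd-+ 1 n = isOdd-suc n
isOdd-+ (suc (suc m)) n = isOdd-+ m n

isOdd-double : ∀ m → isOdd (2 * m) ≡ false
isOdd-double m = begin
  isOdd (m + (m + 0))          ≡⟨ isOdd-+ m (m + 0) ⟩
  isOdd m xor isOdd (m + 0)    ≡⟨ cong (λ k → isOdd m xor isOdd k) (+-identityʳ m) ⟩
  isOdd m xor isOdd m          ≡⟨ xor-same (isOdd m) ⟩
  false                        ∎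
  where open ≡-Reasoning

isOdd-sum : ∀ xs → isOdd (sum xs) ≡ foldr _xor_ false (map isOdd xs)
isOdd-sum [] = refl
isOdd-sum (x ∷ xs) = trans (isOdd-+ x (sum xs)) (cong (isOdd x xor_) (isOdd-sum xs))

odd⇒isOdd : ∀ {n} → Odd n → isOdd n ≡ true
odd⇒isOdd (m , refl) = trans (isOdd-suc (2 * m)) (cong not (isOdd-double m))

isOdd-2^s∸1 : ∀ s → isOdd (2 ^ suc s ∸ 1) ≡ true
isOdd-2^s∸1 s = not-injective (begin
  not (isOdd (2 ^ suc s ∸ 1))    ≡⟨ isOdd-suc (2 ^ suc s ∸ 1) ⟨
  isOdd (suc (2 ^ suc s ∸ 1))    ≡⟨ cong isOdd (m+[n∸m]≡n (m^n>0 2 (suc s))) ⟩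
  isOdd (2 * 2 ^ s)              ≡⟨ isOdd-double (2 ^ s) ⟩
  false                          ∎)
  where open ≡-Reasoning

Word : ℕ → Set
Word s = Vec Bool s

infixr 6 _⊕_
_⊕_ : ∀ {s} → Word s → Word s → Word s
_⊕_ = zipWith _xor_

𝟘 : ∀ {s} → Word s
𝟘 {s} = replicate s false

⊕-self : ∀ {s} (x : Word s) → x ⊕ x ≡ 𝟘
⊕-self [] = refl
⊕-self (b ∷ x) = cong₂ _∷_ (xor-same b) (⊕-self x)

⊕-isAbelianGroup : ∀ s → IsAbelianGroup _≡_ (_⊕_ {s}) 𝟘 (λ x → x)
⊕-isAbelianGroup s = record
  { isGroup = record
    { isMonoid = record
      { isSemigroup = record
        { isMagma = record { isEquivalence = isEquivalence ; ∙-cong = cong₂ _⊕_ }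
        ; assoc = zipWith-assoc xor-assoc }
      ; identity = zipWith-identityˡ xor-identityˡ , zipWith-identityʳ xor-identityʳ }
    ; inverse = ⊕-self , ⊕-self
    ; ⁻¹-cong = λ x≡y → x≡y }
  ; comm = zipWith-comm xor-comm }

⊕-abelianGroup : ℕ → AbelianGroup _ _
⊕-abelianGroup s = record { isAbelianGroup = ⊕-isAbelianGroup s }

module _ {s : ℕ} where
  open AbelianGroup (⊕-abelianGroup s) public
    using ()
    renaming (assoc to ⊕-assoc; comm to ⊕-comm; identityˡ to ⊕-identityˡ; identityʳ to ⊕-identityʳ;
              isCommutativeMonoid to ⊕-isCommutativeMonoid)
  open GroupProperties (AbelianGroup.group (⊕-abelianGroup s)) public
    using () renaming (inverseˡ-unique to ⊕≡𝟘⇒≡)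
  open CommutativeSemigroupProperties (AbelianGroup.commutativeSemigroup (⊕-abelianGroup s)) public
    using () renaming (interchange to ⊕-interchange)

  ⊕-cancelˡ : ∀ (x y : Word s) → x ⊕ (x ⊕ y) ≡ y
  ⊕-cancelˡ x y = begin
    x ⊕ (x ⊕ y)  ≡⟨ ⊕-assoc x x y ⟨
    (x ⊕ x) ⊕ y  ≡⟨ cong (_⊕ y) (⊕-self x) ⟩
    𝟘 ⊕ y        ≡⟨ ⊕-identityˡ y ⟩
    y            ∎
    where open ≡-Reasoning

  ≡⇒⊕≡𝟘 : ∀ {x y : Word s} → x ≡ y → x ⊕ y ≡ 𝟘
  ≡⇒⊕≡𝟘 {x} refl = ⊕-self x

Σ⊕ : ∀ {s} → List (Word s) → Word s
Σ⊕ = foldr _⊕_ 𝟘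

Σ⊕-++ : ∀ {s} (xs ys : List (Word s)) → Σ⊕ (xs ++ ys) ≡ Σ⊕ xs ⊕ Σ⊕ ys
Σ⊕-++ [] ys = sym (⊕-identityˡ (Σ⊕ ys))
Σ⊕-++ (x ∷ xs) ys = trans (cong (x ⊕_) (Σ⊕-++ xs ys)) (sym (⊕-assoc x (Σ⊕ xs) (Σ⊕ ys)))

Σ⊕-map-⊕ : ∀ {s} {A : Set} (f g : A → Word s) xs →
           Σ⊕ (map (λ a → f a ⊕ g a) xs) ≡ Σ⊕ (map f xs) ⊕ Σ⊕ (map g xs)
Σ⊕-map-⊕ f g [] = sym (⊕-identityˡ 𝟘)
Σ⊕-map-⊕ f g (a ∷ xs) =
  trans (cong ((f a ⊕ g a) ⊕_) (Σ⊕-map-⊕ f g xs)) (⊕-interchange (f a) (g a) _ _)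

Σ⊕-concatMap : ∀ {s} {A B : Set} (g : B → Word s) (h : A → List B) xs →
               Σ⊕ (map g (concatMap h xs)) ≡ Σ⊕ (map (λ x → Σ⊕ (map g (h x))) xs)
Σ⊕-concatMap g h [] = refl
Σ⊕-concatMap g h (x ∷ xs) = begin
  Σ⊕ (map g (h x ++ concatMap h xs))               ≡⟨ cong Σ⊕ (map-++ g (h x) (concatMap h xs)) ⟩
  Σ⊕ (map g (h x) ++ map g (concatMap h xs))       ≡⟨ Σ⊕-++ (map g (h x)) (map g (concatMap h xs)) ⟩
  Σ⊕ (map g (h x)) ⊕ Σ⊕ (map g (concatMap h xs))   ≡⟨ cong (Σ⊕ (map g (h x)) ⊕_) (Σ⊕-concatMap g h xs) ⟩
  Σ⊕ (map (λ x → Σ⊕ (map g (h x))) (x ∷ xs))       ∎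
  where open ≡-Reasoning

Σ⊕-↭ : ∀ {s} {xs ys : List (Word s)} → xs ↭ ys → Σ⊕ xs ≡ Σ⊕ ys
Σ⊕-↭ p = foldr-commMonoid (setoid _) ⊕-isCommutativeMonoid (↭⇒↭ₛ p)

infixr 7 _·_
_·_ : ∀ {s} → ℕ → Word s → Word s
zero  · x = 𝟘
suc n · x = x ⊕ n · x

Σ⊕-const : ∀ {s} {A : Set} (x : Word s) (as : List A) → Σ⊕ (map (λ _ → x) as) ≡ length as · x
Σ⊕-const x [] = refl
Σ⊕-const x (a ∷ as) = cong (x ⊕_) (Σ⊕-const x as)

·-parity : ∀ {s} n (x : Word s) → n · x ≡ (if isOdd n then x else 𝟘)
·-parity 0 x = refl
·-parity 1 x = ⊕-identityʳ x
·-parity (suc (suc n)) x = trans (⊕-cancelˡ x (n · x)) (·-parity n x)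

unique-⊆-↭ : ∀ {A : Set} {xs ys : List A} → Unique xs → (∀ {z} → z ∈ xs → z ∈ ys) →
             length xs ≡ length ys → xs ↭ ys
unique-⊆-↭ {xs = []} {[]} _ _ _ = ↭-refl
unique-⊆-↭ {xs = x ∷ xs} (x∉xs ∷ xs!) sub len with ∈-∃++ (sub (here refl))
... | ys₁ , ys₂ , refl = ↭-trans (prep x (unique-⊆-↭ xs! sub′ len′)) (↭-sym (shift x ys₁ ys₂))
  where
  sub′ : ∀ {z} → z ∈ xs → z ∈ ys₁ ++ ys₂
  sub′ z∈xs with ∈-++⁻ ys₁ (sub (there z∈xs))
  ... | inj₁ z∈ys₁         = ∈-++⁺ˡ z∈ys₁
  ... | inj₂ (here refl)   = ⊥-elim (All.lookup x∉xs z∈xs refl)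
  ... | inj₂ (there z∈ys₂) = ∈-++⁺ʳ ys₁ z∈ys₂
  len′ : length xs ≡ length (ys₁ ++ ys₂)
  len′ = suc-injective (begin
    suc (length xs)                   ≡⟨ len ⟩
    length (ys₁ ++ x ∷ ys₂)           ≡⟨ length-++ ys₁ ⟩
    length ys₁ + suc (length ys₂)     ≡⟨ +-suc (length ys₁) (length ys₂) ⟩
    suc (length ys₁ + length ys₂)     ≡⟨ cong suc (length-++ ys₁) ⟨
    suc (length (ys₁ ++ ys₂))         ∎)
    where open ≡-Reasoning

allWords : ∀ s → List (Word s)
allWords zero = [] ∷ []
allWords (suc s) = map (false ∷_) (allWords s) ++ map (true ∷_) (allWords s)

∈-allWords : ∀ {s} (x : Word s) → x ∈ allWords s
∈-allWords [] = here refl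
∈-allWords {suc s} (false ∷ x) = ∈-++⁺ˡ (∈-map⁺ (false ∷_) (∈-allWords x))
∈-allWords {suc s} (true ∷ x) = ∈-++⁺ʳ (map (false ∷_) (allWords s)) (∈-map⁺ (true ∷_) (∈-allWords x))

length-allWords : ∀ s → length (allWords s) ≡ 2 ^ s
length-allWords zero = refl
length-allWords (suc s) = begin
  length (map (false ∷_) W ++ map (true ∷_) W)          ≡⟨ length-++ (map (false ∷_) W) ⟩
  length (map (false ∷_) W) + length (map (true ∷_) W)  ≡⟨ cong₂ _+_ (length-map (false ∷_) W) (length-map (true ∷_) W) ⟩
  length W + length W                                    ≡⟨ cong (λ k → k + k) (length-allWords s) ⟩
  2 ^ s + 2 ^ s                                          ≡⟨ cong (2 ^ s +_) (+-identityʳ (2 ^ s)) ⟨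
  2 ^ suc s                                              ∎
  where
  open ≡-Reasoning
  W = allWords s

Σ⊕-map-false∷ : ∀ {s} (xs : List (Word s)) → Σ⊕ (map (false ∷_) xs) ≡ false ∷ Σ⊕ xs
Σ⊕-map-false∷ [] = refl
Σ⊕-map-false∷ (x ∷ xs) = cong ((false ∷ x) ⊕_) (Σ⊕-map-false∷ xs)

Σ⊕-map-true∷ : ∀ {s} (xs : List (Word s)) → Σ⊕ (map (true ∷_) xs) ≡ isOdd (length xs) ∷ Σ⊕ xs
Σ⊕-map-true∷ [] = refl
Σ⊕-map-true∷ (x ∷ xs) =
  trans (cong ((true ∷ x) ⊕_) (Σ⊕-map-true∷ xs)) (cong (_∷ (x ⊕ Σ⊕ xs)) (sym (isOdd-suc (length xs))))

-- For s ≥ 2 the elements of (ℤ/2)^s sum to zero: each coordinate is 1 in 2^(s-1) words, an even number.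
Σ⊕-allWords : ∀ s → Σ⊕ (allWords (suc (suc s))) ≡ 𝟘
Σ⊕-allWords s = begin
  Σ⊕ (map (false ∷_) W ++ map (true ∷_) W)          ≡⟨ Σ⊕-++ (map (false ∷_) W) (map (true ∷_) W) ⟩
  Σ⊕ (map (false ∷_) W) ⊕ Σ⊕ (map (true ∷_) W)      ≡⟨ cong₂ _⊕_ (Σ⊕-map-false∷ W) (Σ⊕-map-true∷ W) ⟩
  isOdd (length W) ∷ (Σ⊕ W ⊕ Σ⊕ W)                   ≡⟨ cong₂ _∷_ evenly-many (⊕-self (Σ⊕ W)) ⟩
  𝟘                                                  ∎
  where
  open ≡-Reasoning
  W = allWords (suc s)
  evenly-many : isOdd (length W) ≡ false
  evenly-many = trans (cong isOdd (length-allWords (suc s))) (isOdd-double (2 ^ s))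

Σ⊕-unique : ∀ s (xs : List (Word (suc (suc s)))) → Unique xs → length xs ≡ 2 ^ suc (suc s) → Σ⊕ xs ≡ 𝟘
Σ⊕-unique s xs xs! len = trans (Σ⊕-↭ xs↭allWords) (Σ⊕-allWords s)
  where
  xs↭allWords : xs ↭ allWords (suc (suc s))
  xs↭allWords = unique-⊆-↭ xs! (λ {z} _ → ∈-allWords z) (trans len (sym (length-allWords (suc (suc s)))))

bit : Bool → ℕ
bit false = 0
bit true = 1

toBits : ∀ s → ℕ → Word s
toBits zero x = []
toBits (suc s) x = isOdd x ∷ toBits s (x / 2)

fromBits : ∀ {s} → Word s → ℕ
fromBits [] = 0
fromBits (b ∷ w) = bit b + 2 * fromBits w

binary-digit : ∀ x → x ≡ bit (isOdd x) + 2 * (x / 2)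
binary-digit x = begin
  x                           ≡⟨ m≡m%n+[m/n]*n x 2 ⟩
  x % 2 + x / 2 * 2           ≡⟨ cong₂ _+_ (last-digit x) (*-comm (x / 2) 2) ⟩
  bit (isOdd x) + 2 * (x / 2) ∎
  where
  open ≡-Reasoning
  last-digit : ∀ x → x % 2 ≡ bit (isOdd x)
  last-digit 0 = refl
  last-digit 1 = refl
  last-digit (suc (suc x)) = last-digit x

bit+double-injective : ∀ a b m n → bit a + 2 * m ≡ bit b + 2 * n → a ≡ b × m ≡ n
bit+double-injective a b m n e = a≡b , *-cancelˡ-≡ m n 2 (+-cancelˡ-≡ (bit a) (2 * m) (2 * n) e′)
  where
  isOdd-bit+double : ∀ c k → isOdd (bit c + 2 * k) ≡ c
  isOdd-bit+double false k = isOdd-double k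
  isOdd-bit+double true k = trans (isOdd-suc (2 * k)) (cong not (isOdd-double k))
  a≡b : a ≡ b
  a≡b = trans (sym (isOdd-bit+double a m)) (trans (cong isOdd e) (isOdd-bit+double b n))
  e′ : bit a + 2 * m ≡ bit a + 2 * n
  e′ = trans e (cong (λ c → bit c + 2 * n) (sym a≡b))

fromBits-injective : ∀ {s} (u v : Word s) → fromBits u ≡ fromBits v → u ≡ v
fromBits-injective [] [] _ = refl
fromBits-injective (a ∷ u) (b ∷ v) e with bit+double-injective a b (fromBits u) (fromBits v) e
... | refl , e′ = cong (a ∷_) (fromBits-injective u v e′)

2^-nonZero : ∀ s → NonZero (2 ^ s)
2^-nonZero s = m^n≢0 2 s

block : ℕ → ℕ → ℕ
block s x = _/_ x (2 ^ s) {{2^-nonZero s}}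

block-suc : ∀ s x → block (suc s) x ≡ block s (x / 2)
block-suc s x = sym (m/n/o≡m/[n*o] x 2 (2 ^ s) {{_}} {{2^-nonZero s}} {{2^-nonZero (suc s)}})

label-injective : ∀ s x y → toBits s x ≡ toBits s y → block s x ≡ block s y → x ≡ y
label-injective zero x y _ same = trans (sym (n/1≡n x)) (trans same (n/1≡n y))
label-injective (suc s) x y labels same = begin
  x                             ≡⟨ binary-digit x ⟩
  bit (isOdd x) + 2 * (x / 2)   ≡⟨ cong₂ (λ b h → bit b + 2 * h) low high ⟩
  bit (isOdd y) + 2 * (y / 2)   ≡⟨ binary-digit y ⟨
  y                             ∎
  where
  open ≡-Reasoning
  low : isOdd x ≡ isOdd y
  low = proj₁ (∷-injective labels)
  high : x / 2 ≡ y / 2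
  high = label-injective s (x / 2) (y / 2) (proj₂ (∷-injective labels))
           (trans (sym (block-suc s x)) (trans same (block-suc s y)))

-- Adjacency in the host graph: distinct numbers in the same complete block below n.
SameBlock : ℕ → ℕ → ℕ → ℕ → Set
SameBlock s n x y = x ≢ y × block s x ≡ block s y × block s x < block s n

sameBlock? : ∀ s n x y → Dec (SameBlock s n x y)
sameBlock? s n x y = ¬? (x ≟ y) ×-dec block s x ≟ block s y ×-dec block s x <? block s n

SameBlock-sym : ∀ {s n x y} → SameBlock s n x y → SameBlock s n y x
SameBlock-sym (x≢y , same , full) = (λ y≡x → x≢y (sym y≡x)) , sym same , subst (_< _) same full

colour : ℕ → ℕ → ℕ → ℕ
colour s x y = fromBits (toBits s x ⊕ toBits s y)

hostGraph : ∀ s n → ColoredGraph n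
hostGraph s n = record
  { adj    = λ u v → does (sameBlock? s n (toℕ u) (toℕ v))
  ; sym    = λ u v → does-⇔ (mk⇔ (SameBlock-sym {s} {n}) (SameBlock-sym {s} {n}))
                            (sameBlock? s n (toℕ u) (toℕ v)) (sameBlock? s n (toℕ v) (toℕ u))
  ; irrefl = λ u → dec-false (sameBlock? s n (toℕ u) (toℕ u)) (λ (u≢u , _) → u≢u refl)
  ; col    = λ u v → colour s (toℕ u) (toℕ v)
  ; colSym = λ u v → cong fromBits (⊕-comm (toBits s (toℕ u)) (toBits s (toℕ v)))
  }

fromDoes : ∀ {P : Set} (d : Dec P) → does d ≡ true → P
fromDoes (yes p) _ = p

adjacent⇒SameBlock : ∀ s n {u v} → adj (hostGraph s n) u v ≡ true → SameBlock s n (toℕ u) (toℕ v)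
adjacent⇒SameBlock s n {u} {v} = fromDoes (sameBlock? s n (toℕ u) (toℕ v))

-- Properness: the colours at u determine the labels of the neighbours, hence the neighbours.
hostGraph-proper : ∀ s n → Proper (hostGraph s n)
hostGraph-proper s n u v w uv uw v≢w same-colour =
  v≢w (toℕ-injective (label-injective s (toℕ v) (toℕ w) same-label same-block))
  where
  ℓ : Fin n → Word s
  ℓ z = toBits s (toℕ z)
  same-label : ℓ v ≡ ℓ w
  same-label = begin
    ℓ v                ≡⟨ ⊕-cancelˡ (ℓ u) (ℓ v) ⟨
    ℓ u ⊕ (ℓ u ⊕ ℓ v)  ≡⟨ cong (ℓ u ⊕_) (fromBits-injective (ℓ u ⊕ ℓ v) (ℓ u ⊕ ℓ w) same-colour) ⟩
    ℓ u ⊕ (ℓ u ⊕ ℓ w)  ≡⟨ ⊕-cancelˡ (ℓ u) (ℓ w) ⟩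
    ℓ w                ∎
    where open ≡-Reasoning
  same-block : block s (toℕ v) ≡ block s (toℕ w)
  same-block = trans (sym (proj₁ (proj₂ (adjacent⇒SameBlock s n {u} {v} uv))))
                     (proj₁ (proj₂ (adjacent⇒SameBlock s n {u} {w} uw)))

sumBelow : ℕ → (ℕ → ℕ) → ℕ
sumBelow zero    g = 0
sumBelow (suc n) g = sumBelow n g + g n

sumBelow-shift : ∀ n g → sumBelow (suc n) g ≡ g 0 + sumBelow n (g ∘ suc)
sumBelow-shift zero    g = +-comm 0 (g 0)
sumBelow-shift (suc n) g = trans (cong (_+ g (suc n)) (sumBelow-shift n g)) (+-assoc (g 0) _ _)

sumBelow-cong : ∀ n {g h} → (∀ y → y < n → g y ≡ h y) → sumBelow n g ≡ sumBelow n h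
sumBelow-cong zero    _   = refl
sumBelow-cong (suc n) g≡h = cong₂ _+_ (sumBelow-cong n (λ y y<n → g≡h y (m<n⇒m<1+n y<n))) (g≡h n (n<1+n n))

sumBelow-+ : ∀ a d g → sumBelow (a + d) g ≡ sumBelow a g + sumBelow d (λ y → g (a + y))
sumBelow-+ a zero g = trans (cong (λ k → sumBelow k g) (+-identityʳ a)) (sym (+-identityʳ _))
sumBelow-+ a (suc d) g = begin
  sumBelow (a + suc d) g                                      ≡⟨ cong (λ k → sumBelow k g) (+-suc a d) ⟩
  sumBelow (a + d) g + g (a + d)                              ≡⟨ cong (_+ g (a + d)) (sumBelow-+ a d g) ⟩
  sumBelow a g + sumBelow d (λ y → g (a + y)) + g (a + d)     ≡⟨ +-assoc (sumBelow a g) _ _ ⟩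
  sumBelow a g + sumBelow (suc d) (λ y → g (a + y))           ∎
  where open ≡-Reasoning

sumBelow-zeros : ∀ d {g} → (∀ y → g y ≡ 0) → sumBelow d g ≡ 0
sumBelow-zeros zero    _  = refl
sumBelow-zeros (suc d) g≡0 = cong₂ _+_ (sumBelow-zeros d g≡0) (g≡0 d)

sumBelow-mono : ∀ {a n} g → a ≤ n → sumBelow a g ≤ sumBelow n g
sumBelow-mono {a} {n} g a≤n = begin
  sumBelow a g                                               ≤⟨ m≤m+n (sumBelow a g) _ ⟩
  sumBelow a g + sumBelow (n ∸ a) (λ y → g (a + y))         ≡⟨ sumBelow-+ a (n ∸ a) g ⟨
  sumBelow (a + (n ∸ a)) g                                   ≡⟨ cong (λ k → sumBelow k g) (m+[n∸m]≡n a≤n) ⟩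
  sumBelow n g                                               ∎
  where open ≤-Reasoning

sum-tabulate : ∀ n (g : ℕ → ℕ) → sum (tabulate {n = n} (g ∘ toℕ)) ≡ sumBelow n g
sum-tabulate zero    g = refl
sum-tabulate (suc n) g = trans (cong (g 0 +_) (sum-tabulate n (g ∘ suc))) (sym (sumBelow-shift n g))

sum-allFin : ∀ n (g : ℕ → ℕ) → sum (map (g ∘ toℕ) (allFin n)) ≡ sumBelow n g
sum-allFin n g = trans (cong sum (map-tabulate {n = n} (λ i → i) (g ∘ toℕ))) (sum-tabulate n g)

sum-concat : ∀ (xss : List (List ℕ)) → sum (concat xss) ≡ sum (map sum xss)
sum-concat []         = refl
sum-concat (xs ∷ xss) = trans (sum-++ xs (concat xss)) (cong (sum xs +_) (sum-concat xss))

interval-count : ∀ a c n → c ≤ n →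
                 sumBelow n (λ y → if ⌊ a <? y ⌋ ∧ ⌊ y <? c ⌋ then 1 else 0) ≡ c ∸ suc a
interval-count a c n c≤n = begin
  sumBelow n g                                           ≡⟨ cong (λ k → sumBelow k g) (m+[n∸m]≡n c≤n) ⟨
  sumBelow (c + (n ∸ c)) g                               ≡⟨ sumBelow-+ c (n ∸ c) g ⟩
  sumBelow c g + sumBelow (n ∸ c) (λ y → g (c + y))     ≡⟨ cong₂ _+_ (below-c c ≤-refl) (sumBelow-zeros (n ∸ c) beyond-c) ⟩
  c ∸ suc a + 0                                          ≡⟨ +-identityʳ _ ⟩
  c ∸ suc a                                              ∎
  where
  open ≡-Reasoning
  g : ℕ → ℕ
  g y = if ⌊ a <? y ⌋ ∧ ⌊ y <? c ⌋ then 1 else 0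
  beyond-c : ∀ y → g (c + y) ≡ 0
  beyond-c y with a <? c + y | c + y <? c
  ... | _     | yes c+y<c = ⊥-elim (<⇒≱ c+y<c (m≤m+n c y))
  ... | yes _ | no _      = refl
  ... | no _  | no _      = refl
  below-c : ∀ k → k ≤ c → sumBelow k g ≡ k ∸ suc a
  below-c zero _ = refl
  below-c (suc k) k<c with a <? k | k <? c
  ... | _       | no k≮c = ⊥-elim (k≮c k<c)
  ... | yes a<k | yes _  = begin
    sumBelow k g + 1    ≡⟨ cong (_+ 1) (below-c k (<⇒≤ k<c)) ⟩
    k ∸ suc a + 1       ≡⟨ +-∸-comm 1 a<k ⟨
    k + 1 ∸ suc a       ≡⟨ cong (_∸ suc a) (+-comm k 1) ⟩
    suc k ∸ suc a       ∎
  ... | no a≮k  | yes _  = begin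
    sumBelow k g + 0    ≡⟨ +-identityʳ _ ⟩
    sumBelow k g        ≡⟨ below-c k (<⇒≤ k<c) ⟩
    k ∸ suc a           ≡⟨ m≤n⇒m∸n≡0 (m≤n⇒m≤1+n (≮⇒≥ a≮k)) ⟩
    0                   ≡⟨ m≤n⇒m∸n≡0 (≮⇒≥ a≮k) ⟨
    k ∸ a               ∎

-- Σ_{p<k} (k-1-p): the number of edges of a k-clique, counted row by row.
triangle : ℕ → ℕ
triangle k = sumBelow k (λ p → k ∸ suc p)

triangle-formula : ∀ k → 2 * triangle k ≡ k * (k ∸ 1)
triangle-formula zero = refl
triangle-formula (suc k) = begin
  2 * triangle (suc k)            ≡⟨ cong (2 *_) (sumBelow-shift k (k ∸_)) ⟩
  2 * (k + triangle k)            ≡⟨ *-distribˡ-+ 2 k (triangle k) ⟩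
  2 * k + 2 * triangle k          ≡⟨ cong (2 * k +_) (triangle-formula k) ⟩
  2 * k + k * (k ∸ 1)             ≡⟨ gauss-step k ⟩
  suc k * k                       ∎
  where
  open ≡-Reasoning
  gauss-step : ∀ k → 2 * k + k * (k ∸ 1) ≡ suc k * k
  gauss-step zero = refl
  gauss-step (suc j) = polynomial-identity j
    where
    polynomial-identity : ∀ j → 2 * suc j + suc j * j ≡ suc (suc j) * suc j
    polynomial-identity = solve-∀

module Counting (s n : ℕ) where
  private
    m : ℕ
    m = 2 ^ s
    instance
      m-nonZero : NonZero m
      m-nonZero = 2^-nonZero s

  isEdge : ℕ → ℕ → ℕ
  isEdge x y = if ⌊ x <? y ⌋ ∧ does (sameBlock? s n x y) then 1 else 0

  row : ℕ → ℕ
  row x = sumBelow n (isEdge x)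

  edgeCount-hostGraph : edgeCount (hostGraph s n) ≡ sumBelow n row
  edgeCount-hostGraph = begin
    sum (concat (map F (allFin n)))      ≡⟨ sum-concat (map F (allFin n)) ⟩
    sum (map sum (map F (allFin n)))     ≡⟨ cong sum (map-∘ (allFin n)) ⟨
    sum (map (sum ∘ F) (allFin n))       ≡⟨ cong sum (map-cong (λ u → sum-allFin n (isEdge (toℕ u))) (allFin n)) ⟩
    sum (map (row ∘ toℕ) (allFin n))     ≡⟨ sum-allFin n row ⟩
    sumBelow n row                       ∎
    where
    open ≡-Reasoning
    F : Fin n → List ℕ
    F u = map (isEdge (toℕ u) ∘ toℕ) (allFin n)

  block-decompose : ∀ b p → p < m → block s (b * m + p) ≡ b
  block-decompose b p p<m = begin
    (b * m + p) / m       ≡⟨ +-distrib-/-∣ˡ p (n∣m*n b) ⟩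
    b * m / m + p / m     ≡⟨ cong₂ _+_ (m*n/n≡m b m) (m<n⇒m/n≡0 p<m) ⟩
    b + 0                 ≡⟨ +-identityʳ b ⟩
    b                     ∎
    where open ≡-Reasoning

  -- Vertex x = b * m + p of a complete block b has exactly m - 1 - p neighbours y > x:
  -- they are the y with x < y < c = b * m + m.
  module RowOfCompleteBlock (b p : ℕ) (b<B : b < block s n) (p<m : p < m) where
    x c : ℕ
    x = b * m + p
    c = b * m + m

    block-x : block s x ≡ b
    block-x = block-decompose b p p<m

    c≤n : c ≤ n
    c≤n = begin
      b * m + m       ≡⟨ +-comm (b * m) m ⟩
      suc b * m       ≤⟨ *-monoˡ-≤ m b<B ⟩
      block s n * m   ≤⟨ m/n*n≤m n m ⟩
      n               ∎
      where open ≤-Reasoning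

    same-block⇒<c : ∀ {y} → SameBlock s n x y → y < c
    same-block⇒<c {y} (_ , same , _) = begin-strict
      y                      ≡⟨ m≡m%n+[m/n]*n y m ⟩
      y % m + y / m * m      <⟨ +-monoˡ-< (y / m * m) (m%n<n y m) ⟩
      m + y / m * m          ≡⟨ cong (λ k → m + k * m) (trans (sym same) block-x) ⟩
      m + b * m              ≡⟨ +-comm m (b * m) ⟩
      c                      ∎
      where open ≤-Reasoning

    <c⇒same-block : ∀ {y} → x < y → y < c → SameBlock s n x y
    <c⇒same-block {y} x<y y<c =
      <⇒≢ x<y , trans block-x (≤-antisym b≤y/m y/m≤b) , subst (_< block s n) (sym block-x) b<B
      where
      b≤y/m : b ≤ y / m
      b≤y/m = subst (_≤ y / m) (m*n/n≡m b m) (/-monoˡ-≤ m (≤-trans (m≤m+n (b * m) p) (<⇒≤ x<y)))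
      y/m≤b : y / m ≤ b
      y/m≤b = s≤s⁻¹ (m<n*o⇒m/o<n (subst (y <_) (+-comm (b * m) m) y<c))

    isEdge≡interval : ∀ y → isEdge x y ≡ (if ⌊ x <? y ⌋ ∧ ⌊ y <? c ⌋ then 1 else 0)
    isEdge≡interval y with x <? y
    ... | no _    = refl
    ... | yes x<y = cong (λ t → if t then 1 else 0)
                      (trans (does-⇔ (mk⇔ same-block⇒<c (<c⇒same-block x<y)) (sameBlock? s n x y) (y <? c))
                             (sym (isYes≗does (y <? c))))

    row-count : row x ≡ m ∸ suc p
    row-count = begin
      sumBelow n (isEdge x)                                           ≡⟨ sumBelow-cong n (λ y _ → isEdge≡interval y) ⟩
      sumBelow n (λ y → if ⌊ x <? y ⌋ ∧ ⌊ y <? c ⌋ then 1 else 0)  ≡⟨ interval-count x c n c≤n ⟩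
      c ∸ suc x                                                       ≡⟨ cong (c ∸_) (+-suc (b * m) p) ⟨
      (b * m + m) ∸ (b * m + suc p)                                   ≡⟨ [m+n]∸[m+o]≡n∸o (b * m) m (suc p) ⟩
      m ∸ suc p                                                       ∎
      where open ≡-Reasoning

  complete-blocks : ∀ b → b ≤ block s n → sumBelow (b * m) row ≡ b * triangle m
  complete-blocks zero _ = refl
  complete-blocks (suc b) b<B = begin
    sumBelow (m + b * m) row                                ≡⟨ cong (λ k → sumBelow k row) (+-comm m (b * m)) ⟩
    sumBelow (b * m + m) row                                ≡⟨ sumBelow-+ (b * m) m row ⟩
    sumBelow (b * m) row + sumBelow m (λ p → row (b * m + p))
      ≡⟨ cong₂ _+_ (complete-blocks b (<⇒≤ b<B)) (sumBelow-cong m (λ p p<m → RowOfCompleteBlock.row-count b p b<B p<m)) ⟩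
    b * triangle m + triangle m                             ≡⟨ +-comm (b * triangle m) (triangle m) ⟩
    suc b * triangle m                                      ∎
    where open ≡-Reasoning

  -- (m - 1) n ≤ 2 e(G) + (m - 1) m, since all but fewer than m vertices lie in complete blocks.
  edge-bound : (m ∸ 1) * n ≤ 2 * edgeCount (hostGraph s n) + (m ∸ 1) * m
  edge-bound = begin
    k * n                                   ≡⟨ cong (k *_) (m≡m%n+[m/n]*n n m) ⟩
    k * (n % m + B * m)                     ≡⟨ *-distribˡ-+ k (n % m) (B * m) ⟩
    k * (n % m) + k * (B * m)               ≤⟨ +-monoˡ-≤ (k * (B * m)) (*-monoʳ-≤ k (<⇒≤ (m%n<n n m))) ⟩
    k * m + k * (B * m)                     ≡⟨ +-comm (k * m) (k * (B * m)) ⟩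
    k * (B * m) + k * m                     ≡⟨ cong (_+ k * m) (rearrange k B m) ⟩
    B * (m * k) + k * m                     ≡⟨ cong (λ t → B * t + k * m) (triangle-formula m) ⟨
    B * (2 * triangle m) + k * m            ≡⟨ cong (_+ k * m) (*-comm-2 B (triangle m)) ⟩
    2 * (B * triangle m) + k * m            ≤⟨ +-monoˡ-≤ (k * m) (*-monoʳ-≤ 2 complete-part) ⟩
    2 * edgeCount (hostGraph s n) + k * m   ∎
    where
    open ≤-Reasoning
    k B : ℕ
    k = m ∸ 1
    B = block s n
    rearrange : ∀ k B m → k * (B * m) ≡ B * (m * k)
    rearrange = solve-∀
    *-comm-2 : ∀ B t → B * (2 * t) ≡ 2 * (B * t)
    *-comm-2 = solve-∀
    complete-part : B * triangle m ≤ edgeCount (hostGraph s n)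
    complete-part = begin
      B * triangle m                 ≡⟨ complete-blocks B ≤-refl ⟨
      sumBelow (B * m) row           ≤⟨ sumBelow-mono row (m/n*n≤m n m) ⟩
      sumBelow n row                 ≡⟨ edgeCount-hostGraph ⟨
      edgeCount (hostGraph s n)      ∎

module RainbowCopyInHostGraph (s n : ℕ) (F : PatternGraph) (copy : RainbowCopy F (hostGraph (suc (suc s)) n))
                              (size : length (edges F) ≡ 2 ^ suc (suc s) ∸ 1) where
  S : ℕ
  S = suc (suc s)

  φ : Vtx F → Fin n
  φ = proj₁ copy

  L : Vtx F → Word S
  L v = toBits S (toℕ (φ v))

  blk : Vtx F → ℕ
  blk v = block S (toℕ (φ v))

  colourWord : Vtx F × Vtx F → Word S
  colourWord (a , b) = L a ⊕ L b

  edge-same-block : ∀ {a b} → (a , b) ∈ edges F → SameBlock S n (toℕ (φ a)) (toℕ (φ b))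
  edge-same-block e∈F = adjacent⇒SameBlock S n (proj₁ (proj₂ (proj₂ copy)) e∈F)

  same-block-and-label : ∀ {a b} → blk a ≡ blk b → L a ≡ L b → a ≡ b
  same-block-and-label {a} {b} same-block same-label =
    proj₁ (proj₂ copy) a b (toℕ-injective (label-injective S (toℕ (φ a)) (toℕ (φ b)) same-label same-block))

  1+size : suc (length (edges F)) ≡ 2 ^ S
  1+size = trans (cong suc size) (m+[n∸m]≡n (m^n>0 2 S))

  -- The colour words are pairwise distinct (rainbow) and nonzero (edges join distinct vertices
  -- of one block), so together with 𝟘 they are 2^S distinct words.
  colourWords-unique : Unique (𝟘 ∷ map colourWord (edges F))
  colourWords-unique =
    AllProperties.map⁺ (All.tabulate nonzero) ∷
    Unique.map⁻ (subst Unique (map-∘ {g = fromBits} {f = colourWord} (edges F)) (proj₂ (proj₂ (proj₂ copy))))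
    where
    nonzero : ∀ {e} → e ∈ edges F → 𝟘 ≢ colourWord e
    nonzero {a , b} e∈F 𝟘≡ = proj₁ (edge-same-block e∈F)
      (cong (toℕ ∘ φ) (same-block-and-label (proj₁ (proj₂ (edge-same-block e∈F))) (⊕≡𝟘⇒≡ (L a) (L b) (sym 𝟘≡))))

  colourWord-sum : Σ⊕ (map colourWord (edges F)) ≡ 𝟘
  colourWord-sum = trans (sym (⊕-identityˡ _))
    (Σ⊕-unique s (𝟘 ∷ map colourWord (edges F)) colourWords-unique
                (trans (cong suc (length-map colourWord (edges F))) 1+size))

  -- If the copy lies in the block of a root r and every vertex other than r is the second
  -- endpoint of exactly one edge, then the first endpoints of the edges sum to the label of r.
  module Rooted (r : Vtx F) (one-block : ∀ v → blk v ≡ blk r) (spanning : Unique (r ∷ map proj₂ (edges F))) where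

    vertex-sum : L r ⊕ Σ⊕ (map (L ∘ proj₂) (edges F)) ≡ 𝟘
    vertex-sum = trans (cong (λ ls → L r ⊕ Σ⊕ ls) (map-∘ (edges F)))
                       (Σ⊕-unique s (map L (r ∷ map proj₂ (edges F))) labels-unique labels-count)
      where
      labels-unique : Unique (map L (r ∷ map proj₂ (edges F)))
      labels-unique = Unique.map⁺ (λ {a} {b} → same-block-and-label (trans (one-block a) (sym (one-block b)))) spanning
      labels-count : length (map L (r ∷ map proj₂ (edges F))) ≡ 2 ^ S
      labels-count = trans (cong suc (trans (length-map L (map proj₂ (edges F))) (length-map proj₂ (edges F)))) 1+size

    root-sum : Σ⊕ (map (L ∘ proj₁) (edges F)) ≡ L r
    root-sum = begin
      Σ⊕ (map (L ∘ proj₁) (edges F))   ≡⟨ ⊕≡𝟘⇒≡ _ _ (trans (sym (Σ⊕-map-⊕ (L ∘ proj₁) (L ∘ proj₂) (edges F))) colourWord-sum) ⟩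
      Σ⊕ (map (L ∘ proj₂) (edges F))   ≡⟨ ⊕≡𝟘⇒≡ (L r) _ vertex-sum ⟨
      L r                              ∎
      where open ≡-Reasoning

length-concatMap : ∀ {A B : Set} (h : A → List B) xs → length (concatMap h xs) ≡ sum (map (length ∘ h) xs)
length-concatMap h [] = refl
length-concatMap h (x ∷ xs) = trans (length-++ (h x)) (cong (length (h x) +_) (length-concatMap h xs))

-- Bookkeeping for the caterpillar CP σ: its edges are the spine edges (v_i, v_{i+1}) followed,
-- for every spine vertex, by the leaf edges (v_i, leaf) — each edge oriented away from v₁.
module _ (σ : List ℕ) where

  spineEdges : List (CPVtx σ × CPVtx σ)
  spineEdges = map (λ e → spine {σ} (proj₁ e) , spine {σ} (proj₂ e)) (pathEdges (length σ))

  leafBlock : Fin (length σ) → List (CPVtx σ × CPVtx σ)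
  leafBlock i = map (λ j → spine {σ} i , leaf {σ} i j) (allFin (lookup σ i))

  leafEdges : List (CPVtx σ × CPVtx σ)
  leafEdges = concatMap leafBlock (allFin (length σ))

  spines : List (CPVtx σ)
  spines = map (spine {σ}) (allFin (length σ))

  leaves : List (CPVtx σ)
  leaves = concatMap (λ i → map (leaf {σ} i) (allFin (lookup σ i))) (allFin (length σ))

  leaf-edge-∈ : ∀ i j → (spine {σ} i , leaf {σ} i j) ∈ edges (CP σ)
  leaf-edge-∈ i j = ∈-++⁺ʳ spineEdges (∈-concat⁺′ (∈-map⁺ (λ j → spine {σ} i , leaf {σ} i j) (∈-allFin j))
                                                 (∈-map⁺ leafBlock (∈-allFin i)))

  leafEdge-targets : map proj₂ leafEdges ≡ leaves
  leafEdge-targets = begin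
    map proj₂ (concat (map leafBlock (allFin (length σ))))           ≡⟨ concat-map (map leafBlock (allFin (length σ))) ⟨
    concat (map (map proj₂) (map leafBlock (allFin (length σ))))     ≡⟨ cong concat (map-∘ (allFin (length σ))) ⟨
    concat (map (map proj₂ ∘ leafBlock) (allFin (length σ)))         ≡⟨ cong concat (map-cong (λ i → map-∘ (allFin (lookup σ i))) (allFin (length σ))) ⟨
    leaves                                                           ∎
    where open ≡-Reasoning

  leaves-unique : Unique leaves
  leaves-unique = Unique.concat⁺ (AllProperties.map⁺ (All.tabulate (λ _ → Unique.map⁺ leaf-injective (Unique.allFin⁺ _))))
                                 (AllPairsProperties.map⁺ (AllPairs.map blocks-disjoint (Unique.allFin⁺ (length σ))))
    where
    leaf-injective : ∀ {i j j′} → leaf {σ} i j ≡ leaf {σ} i j′ → j ≡ j′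
    leaf-injective refl = refl
    blocks-disjoint : ∀ {i i′} → i ≢ i′ → Disjoint (map (leaf {σ} i) (allFin (lookup σ i))) (map (leaf {σ} i′) (allFin (lookup σ i′)))
    blocks-disjoint {i} {i′} i≢i′ (v∈i , v∈i′) with ∈-map⁻ (leaf {σ} i) v∈i | ∈-map⁻ (leaf {σ} i′) v∈i′
    ... | _ , _ , refl | _ , _ , refl = i≢i′ refl

  spine∉leaves : ∀ i → spine {σ} i ∉ leaves
  spine∉leaves i s∈leaves with ∈-concat⁻′ (map (λ i → map (leaf {σ} i) (allFin (lookup σ i))) (allFin (length σ))) s∈leaves
  ... | _ , s∈block , block∈blocks with ∈-map⁻ (λ i → map (leaf {σ} i) (allFin (lookup σ i))) block∈blocks
  ... | i′ , _ , refl with ∈-map⁻ (leaf {σ} i′) s∈block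
  ... | _ , _ , ()

  -- For a concrete spine length, spines ++ map proj₂ leafEdges computes to
  -- v₁ ∷ map proj₂ (edges (CP σ)): the orientation away from v₁ reaches every vertex exactly once.
  vertices-unique : Unique (spines ++ map proj₂ leafEdges)
  vertices-unique = subst (λ ls → Unique (spines ++ ls)) (sym leafEdge-targets)
    (Unique.++⁺ (Unique.map⁺ spine-injective (Unique.allFin⁺ (length σ))) leaves-unique spines-not-leaves)
    where
    spine-injective : ∀ {i j} → spine {σ} i ≡ spine {σ} j → i ≡ j
    spine-injective refl = refl
    spines-not-leaves : Disjoint spines leaves
    spines-not-leaves (v∈spines , v∈leaves) with ∈-map⁻ (spine {σ}) v∈spines
    ... | i , _ , refl = spine∉leaves i v∈leaves


  caterpillar-size : length (edges (CP σ)) ≡ length (pathEdges (length σ)) + sum (map (lookup σ) (allFin (length σ)))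
  caterpillar-size = begin
    length (spineEdges ++ leafEdges)                          ≡⟨ length-++ spineEdges ⟩
    length spineEdges + length leafEdges                  ≡⟨ cong₂ _+_ (length-map _ (pathEdges (length σ))) (length-concatMap leafBlock (allFin (length σ))) ⟩
    length (pathEdges (length σ)) + sum (map (length ∘ leafBlock) (allFin (length σ)))
      ≡⟨ cong (λ ls → length (pathEdges (length σ)) + sum ls) (map-cong block-size (allFin (length σ))) ⟩
    length (pathEdges (length σ)) + sum (map (lookup σ) (allFin (length σ))) ∎
    where
    open ≡-Reasoning
    block-size : ∀ i → length (leafBlock i) ≡ lookup σ i
    block-size i = trans (length-map _ (allFin (lookup σ i))) (length-tabulate {n = lookup σ i} (λ j → j))

  -- Summing f over the first endpoints of the edges: v_i is the first endpoint of its s_i leaf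
  -- edges and of the spine edge (v_i, v_{i+1}).
  first-endpoint-sum : ∀ {s} (f : CPVtx σ → Word s) →
    Σ⊕ (map (f ∘ proj₁) (edges (CP σ))) ≡
    Σ⊕ (map (f ∘ proj₁) spineEdges) ⊕ Σ⊕ (map (λ i → lookup σ i · f (spine i)) (allFin (length σ)))
  first-endpoint-sum f = begin
    Σ⊕ (map (f ∘ proj₁) (spineEdges ++ leafEdges))                  ≡⟨ cong Σ⊕ (map-++ (f ∘ proj₁) spineEdges leafEdges) ⟩
    Σ⊕ (map (f ∘ proj₁) spineEdges ++ map (f ∘ proj₁) leafEdges) ≡⟨ Σ⊕-++ (map (f ∘ proj₁) spineEdges) _ ⟩
    Σ⊕ (map (f ∘ proj₁) spineEdges) ⊕ Σ⊕ (map (f ∘ proj₁) leafEdges)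
      ≡⟨ cong (Σ⊕ (map (f ∘ proj₁) spineEdges) ⊕_) (trans (Σ⊕-concatMap (f ∘ proj₁) leafBlock (allFin (length σ)))
                                                              (cong Σ⊕ (map-cong block-sum (allFin (length σ))))) ⟩
    Σ⊕ (map (f ∘ proj₁) spineEdges) ⊕ Σ⊕ (map (λ i → lookup σ i · f (spine i)) (allFin (length σ))) ∎
    where
    open ≡-Reasoning
    block-sum : ∀ i → Σ⊕ (map (f ∘ proj₁) (leafBlock i)) ≡ lookup σ i · f (spine i)
    block-sum i = begin
      Σ⊕ (map (f ∘ proj₁) (leafBlock i))              ≡⟨ cong Σ⊕ (map-∘ (allFin (lookup σ i))) ⟨
      Σ⊕ (map (λ _ → f (spine i)) (allFin (lookup σ i))) ≡⟨ Σ⊕-const (f (spine i)) (allFin (lookup σ i)) ⟩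
      length (allFin (lookup σ i)) · f (spine i)        ≡⟨ cong (_· f (spine i)) (length-tabulate {n = lookup σ i} (λ j → j)) ⟩
      lookup σ i · f (spine i)                          ∎

module CaterpillarCopy (s n : ℕ) (σ : List ℕ) (copy : RainbowCopy (CP σ) (hostGraph (suc (suc s)) n))
                       (size : length (edges (CP σ)) ≡ 2 ^ suc (suc s) ∸ 1) where
  open RainbowCopyInHostGraph s n (CP σ) copy size public

  size-parity : isOdd (length (pathEdges (length σ))) xor foldr _xor_ false (map isOdd (map (lookup σ) (allFin (length σ)))) ≡ true
  size-parity = begin
    isOdd (length (pathEdges (length σ))) xor foldr _xor_ false (map isOdd (map (lookup σ) (allFin (length σ))))
      ≡⟨ cong (isOdd (length (pathEdges (length σ))) xor_) (isOdd-sum (map (lookup σ) (allFin (length σ)))) ⟨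
    isOdd (length (pathEdges (length σ))) xor isOdd (sum (map (lookup σ) (allFin (length σ))))
      ≡⟨ isOdd-+ (length (pathEdges (length σ))) _ ⟨
    isOdd (length (pathEdges (length σ)) + sum (map (lookup σ) (allFin (length σ))))
      ≡⟨ cong isOdd (caterpillar-size σ) ⟨
    isOdd (length (edges (CP σ)))   ≡⟨ cong isOdd size ⟩
    isOdd (2 ^ suc (suc s) ∸ 1)     ≡⟨ isOdd-2^s∸1 (suc s) ⟩
    true                            ∎
    where open ≡-Reasoning

  edge-block : ∀ {a b} → (a , b) ∈ edges (CP σ) → blk b ≡ blk a
  edge-block e∈F = sym (proj₁ (proj₂ (edge-same-block e∈F)))

  module Spanning (r : Fin (length σ)) (spine-blocks : ∀ i → blk (spine i) ≡ blk (spine r))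
                  (spanning : Unique (spine r ∷ map proj₂ (edges (CP σ)))) where

    one-block : ∀ v → blk v ≡ blk (spine r)
    one-block (spine i)  = spine-blocks i
    one-block (leaf i j) = trans (edge-block (leaf-edge-∈ σ i j)) (spine-blocks i)

    open Rooted (spine r) one-block spanning public

    labels-distinguish : ∀ {a b} → L a ≡ L b → a ≡ b
    labels-distinguish {a} {b} = same-block-and-label (trans (one-block a) (sym (one-block b)))

    spine-relation : L (spine r) ≡ Σ⊕ (map (L ∘ proj₁) (spineEdges σ)) ⊕ Σ⊕ (map (λ i → lookup σ i · L (spine i)) (allFin (length σ)))
    spine-relation = trans (sym root-sum) (first-endpoint-sum σ L)

-- The coefficient of L v_i has the parity of deg(v_i) + 1, so the relation says that the labels
-- of the spine vertices of even degree sum to 𝟘.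
module TwoSpines (s n x₀ x₁ : ℕ) (copy : RainbowCopy (CP (x₀ ∷ x₁ ∷ [])) (hostGraph (suc (suc s)) n))
                 (size : length (edges (CP (x₀ ∷ x₁ ∷ []))) ≡ 2 ^ suc (suc s) ∸ 1) where
  open CaterpillarCopy s n (x₀ ∷ x₁ ∷ []) copy size public

  spine-blocks : ∀ i → blk (spine i) ≡ blk (spine 0F)
  spine-blocks 0F        = refl
  spine-blocks (sucF 0F) = edge-block (here refl)

  open Spanning 0F spine-blocks (vertices-unique (x₀ ∷ x₁ ∷ [])) public

  a b : Word S
  a = L (spine 0F)
  b = L (spine (sucF 0F))

  relation : (if isOdd x₀ then a else 𝟘) ⊕ (if isOdd x₁ then b else 𝟘) ≡ 𝟘
  relation = begin
    (if isOdd x₀ then a else 𝟘) ⊕ (if isOdd x₁ then b else 𝟘)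
      ≡⟨ cong₂ _⊕_ (·-parity (suc (suc x₀)) a) (·-parity x₁ b) ⟨
    (a ⊕ suc x₀ · a) ⊕ x₁ · b                      ≡⟨ ⊕-assoc a (suc x₀ · a) _ ⟩
    a ⊕ (suc x₀ · a ⊕ x₁ · b)                      ≡⟨ cong (a ⊕_) collect ⟨
    a ⊕ ((a ⊕ 𝟘) ⊕ (x₀ · a ⊕ (x₁ · b ⊕ 𝟘)))        ≡⟨ ≡⇒⊕≡𝟘 spine-relation ⟩
    𝟘                                              ∎
    where
    open ≡-Reasoning
    collect : (a ⊕ 𝟘) ⊕ (x₀ · a ⊕ (x₁ · b ⊕ 𝟘)) ≡ suc x₀ · a ⊕ x₁ · b
    collect = begin
      (a ⊕ 𝟘) ⊕ (x₀ · a ⊕ (x₁ · b ⊕ 𝟘))   ≡⟨ cong (_⊕ (x₀ · a ⊕ (x₁ · b ⊕ 𝟘))) (⊕-identityʳ a) ⟩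
      a ⊕ (x₀ · a ⊕ (x₁ · b ⊕ 𝟘))         ≡⟨ ⊕-assoc a (x₀ · a) _ ⟨
      suc x₀ · a ⊕ (x₁ · b ⊕ 𝟘)           ≡⟨ cong (suc x₀ · a ⊕_) (⊕-identityʳ (x₁ · b)) ⟩
      suc x₀ · a ⊕ x₁ · b                 ∎

module ThreeSpines (s n x₀ x₁ x₂ : ℕ) (copy : RainbowCopy (CP (x₀ ∷ x₁ ∷ x₂ ∷ [])) (hostGraph (suc (suc s)) n))
                   (size : length (edges (CP (x₀ ∷ x₁ ∷ x₂ ∷ []))) ≡ 2 ^ suc (suc s) ∸ 1) where
  open CaterpillarCopy s n (x₀ ∷ x₁ ∷ x₂ ∷ []) copy size public

  spine-blocks : ∀ i → blk (spine i) ≡ blk (spine 0F)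
  spine-blocks 0F               = refl
  spine-blocks (sucF 0F)        = edge-block (here refl)
  spine-blocks (sucF (sucF 0F)) = trans (edge-block (there (here refl))) (edge-block (here refl))

  open Spanning 0F spine-blocks (vertices-unique (x₀ ∷ x₁ ∷ x₂ ∷ [])) public

  a b c : Word S
  a = L (spine 0F)
  b = L (spine (sucF 0F))
  c = L (spine (sucF (sucF 0F)))

  relation : (if isOdd x₀ then a else 𝟘) ⊕ ((if isOdd (suc x₁) then b else 𝟘) ⊕ (if isOdd x₂ then c else 𝟘)) ≡ 𝟘
  relation = begin
    (if isOdd x₀ then a else 𝟘) ⊕ ((if isOdd (suc x₁) then b else 𝟘) ⊕ (if isOdd x₂ then c else 𝟘))
      ≡⟨ cong₂ _⊕_ (·-parity (suc (suc x₀)) a) (cong₂ _⊕_ (·-parity (suc x₁) b) (·-parity x₂ c)) ⟨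
    (a ⊕ suc x₀ · a) ⊕ (suc x₁ · b ⊕ x₂ · c)          ≡⟨ ⊕-assoc a (suc x₀ · a) _ ⟩
    a ⊕ (suc x₀ · a ⊕ (suc x₁ · b ⊕ x₂ · c))          ≡⟨ cong (a ⊕_) collect ⟨
    a ⊕ ((a ⊕ (b ⊕ 𝟘)) ⊕ (x₀ · a ⊕ (x₁ · b ⊕ (x₂ · c ⊕ 𝟘))))  ≡⟨ ≡⇒⊕≡𝟘 spine-relation ⟩
    𝟘                                                  ∎
    where
    open ≡-Reasoning
    collect : (a ⊕ (b ⊕ 𝟘)) ⊕ (x₀ · a ⊕ (x₁ · b ⊕ (x₂ · c ⊕ 𝟘))) ≡ suc x₀ · a ⊕ (suc x₁ · b ⊕ x₂ · c)
    collect = begin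
      (a ⊕ (b ⊕ 𝟘)) ⊕ (x₀ · a ⊕ (x₁ · b ⊕ (x₂ · c ⊕ 𝟘)))   ≡⟨ ⊕-interchange a (b ⊕ 𝟘) (x₀ · a) _ ⟩
      suc x₀ · a ⊕ ((b ⊕ 𝟘) ⊕ (x₁ · b ⊕ (x₂ · c ⊕ 𝟘)))     ≡⟨ cong (suc x₀ · a ⊕_) (⊕-interchange b 𝟘 (x₁ · b) _) ⟩
      suc x₀ · a ⊕ (suc x₁ · b ⊕ (𝟘 ⊕ (x₂ · c ⊕ 𝟘)))       ≡⟨ cong (λ w → suc x₀ · a ⊕ (suc x₁ · b ⊕ w)) (trans (⊕-identityˡ _) (⊕-identityʳ _)) ⟩
      suc x₀ · a ⊕ (suc x₁ · b ⊕ x₂ · c)                   ∎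

module FourSpines (s n x₀ x₁ x₂ x₃ : ℕ) (copy : RainbowCopy (CP (x₀ ∷ x₁ ∷ x₂ ∷ x₃ ∷ [])) (hostGraph (suc (suc s)) n))
                  (size : length (edges (CP (x₀ ∷ x₁ ∷ x₂ ∷ x₃ ∷ []))) ≡ 2 ^ suc (suc s) ∸ 1) where
  open CaterpillarCopy s n (x₀ ∷ x₁ ∷ x₂ ∷ x₃ ∷ []) copy size public

  spine-blocks : ∀ i → blk (spine i) ≡ blk (spine 0F)
  spine-blocks 0F                      = refl
  spine-blocks (sucF 0F)               = edge-block (here refl)
  spine-blocks (sucF (sucF 0F))        = trans (edge-block (there (here refl))) (edge-block (here refl))
  spine-blocks (sucF (sucF (sucF 0F))) = trans (edge-block (there (there (here refl))))
                                         (trans (edge-block (there (here refl))) (edge-block (here refl)))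

  open Spanning 0F spine-blocks (vertices-unique (x₀ ∷ x₁ ∷ x₂ ∷ x₃ ∷ [])) public

  a b c d : Word S
  a = L (spine 0F)
  b = L (spine (sucF 0F))
  c = L (spine (sucF (sucF 0F)))
  d = L (spine (sucF (sucF (sucF 0F))))

  relation : (if isOdd x₀ then a else 𝟘) ⊕ ((if isOdd (suc x₁) then b else 𝟘) ⊕
             ((if isOdd (suc x₂) then c else 𝟘) ⊕ (if isOdd x₃ then d else 𝟘))) ≡ 𝟘
  relation = begin
    (if isOdd x₀ then a else 𝟘) ⊕ ((if isOdd (suc x₁) then b else 𝟘) ⊕ ((if isOdd (suc x₂) then c else 𝟘) ⊕ (if isOdd x₃ then d else 𝟘)))
      ≡⟨ cong₂ _⊕_ (·-parity (suc (suc x₀)) a) (cong₂ _⊕_ (·-parity (suc x₁) b) (cong₂ _⊕_ (·-parity (suc x₂) c) (·-parity x₃ d))) ⟨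
    (a ⊕ suc x₀ · a) ⊕ (suc x₁ · b ⊕ (suc x₂ · c ⊕ x₃ · d))          ≡⟨ ⊕-assoc a (suc x₀ · a) _ ⟩
    a ⊕ (suc x₀ · a ⊕ (suc x₁ · b ⊕ (suc x₂ · c ⊕ x₃ · d)))          ≡⟨ cong (a ⊕_) collect ⟨
    a ⊕ ((a ⊕ (b ⊕ (c ⊕ 𝟘))) ⊕ (x₀ · a ⊕ (x₁ · b ⊕ (x₂ · c ⊕ (x₃ · d ⊕ 𝟘)))))  ≡⟨ ≡⇒⊕≡𝟘 spine-relation ⟩
    𝟘                                                                 ∎
    where
    open ≡-Reasoning
    collect : (a ⊕ (b ⊕ (c ⊕ 𝟘))) ⊕ (x₀ · a ⊕ (x₁ · b ⊕ (x₂ · c ⊕ (x₃ · d ⊕ 𝟘)))) ≡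
              suc x₀ · a ⊕ (suc x₁ · b ⊕ (suc x₂ · c ⊕ x₃ · d))
    collect = begin
      (a ⊕ (b ⊕ (c ⊕ 𝟘))) ⊕ (x₀ · a ⊕ (x₁ · b ⊕ (x₂ · c ⊕ (x₃ · d ⊕ 𝟘))))
        ≡⟨ ⊕-interchange a (b ⊕ (c ⊕ 𝟘)) (x₀ · a) _ ⟩
      suc x₀ · a ⊕ ((b ⊕ (c ⊕ 𝟘)) ⊕ (x₁ · b ⊕ (x₂ · c ⊕ (x₃ · d ⊕ 𝟘))))
        ≡⟨ cong (suc x₀ · a ⊕_) (⊕-interchange b (c ⊕ 𝟘) (x₁ · b) _) ⟩
      suc x₀ · a ⊕ (suc x₁ · b ⊕ ((c ⊕ 𝟘) ⊕ (x₂ · c ⊕ (x₃ · d ⊕ 𝟘))))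
        ≡⟨ cong (λ w → suc x₀ · a ⊕ (suc x₁ · b ⊕ w)) (⊕-interchange c 𝟘 (x₂ · c) _) ⟩
      suc x₀ · a ⊕ (suc x₁ · b ⊕ (suc x₂ · c ⊕ (𝟘 ⊕ (x₃ · d ⊕ 𝟘))))
        ≡⟨ cong (λ w → suc x₀ · a ⊕ (suc x₁ · b ⊕ (suc x₂ · c ⊕ w))) (trans (⊕-identityˡ _) (⊕-identityʳ _)) ⟩
      suc x₀ · a ⊕ (suc x₁ · b ⊕ (suc x₂ · c ⊕ x₃ · d))     ∎

first≢third : ∀ {A : Set} {x y z : A} {zs} → Unique (x ∷ y ∷ z ∷ zs) → x ≢ z
first≢third ((_ ∷ x≢z ∷ _) ∷ _) = x≢z

-- (a) CP(1,t,1): k = t + 4 odd forces t odd; the relation reads L v₁ ⊕ L v₃ = 𝟘.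
no-rainbow-a : ∀ s n t → length (edges (CP (1 ∷ t ∷ 1 ∷ []))) ≡ 2 ^ suc (suc s) ∸ 1 →
               ¬ RainbowCopy (CP (1 ∷ t ∷ 1 ∷ [])) (hostGraph (suc (suc s)) n)
no-rainbow-a s n t size copy = s₀≢s₂ (labels-distinguish (⊕≡𝟘⇒≡ a c a⊕c≡𝟘))
  where
  open ThreeSpines s n 1 t 1 copy size
  s₀≢s₂ : spine 0F ≢ spine (sucF (sucF 0F))
  s₀≢s₂ ()
  odd-middle : ∀ p → true xor (p xor (true xor false)) ≡ true → p ≡ true
  odd-middle true  _ = refl
  odd-middle false ()
  a⊕c≡𝟘 : a ⊕ c ≡ 𝟘
  a⊕c≡𝟘 = begin
    a ⊕ c                                          ≡⟨ cong (a ⊕_) (⊕-identityˡ c) ⟨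
    a ⊕ (𝟘 ⊕ c)                                    ≡⟨ cong (λ p → a ⊕ ((if p then b else 𝟘) ⊕ c)) even-suc ⟨
    a ⊕ ((if isOdd (suc t) then b else 𝟘) ⊕ c)     ≡⟨ relation ⟩
    𝟘                                              ∎
    where
    open ≡-Reasoning
    even-suc : isOdd (suc t) ≡ false
    even-suc = trans (isOdd-suc t) (cong not (odd-middle (isOdd t) size-parity))

-- (b) CP(t,q), t, q odd: the relation reads L v₁ ⊕ L v₂ = 𝟘.
no-rainbow-b : ∀ s n t q → Odd t → Odd q → length (edges (CP (t ∷ q ∷ []))) ≡ 2 ^ suc (suc s) ∸ 1 →
               ¬ RainbowCopy (CP (t ∷ q ∷ [])) (hostGraph (suc (suc s)) n)
no-rainbow-b s n t q t-odd q-odd size copy = s₀≢s₁ (labels-distinguish (⊕≡𝟘⇒≡ a b a⊕b≡𝟘))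
  where
  open TwoSpines s n t q copy size
  s₀≢s₁ : spine 0F ≢ spine (sucF 0F)
  s₀≢s₁ ()
  a⊕b≡𝟘 : a ⊕ b ≡ 𝟘
  a⊕b≡𝟘 = subst₂ (λ p p′ → (if p then a else 𝟘) ⊕ (if p′ then b else 𝟘) ≡ 𝟘) (odd⇒isOdd t-odd) (odd⇒isOdd q-odd) relation

-- (c) CP(t,0,q): t + q is odd, and the relation identifies v₁ with v₂ or v₂ with v₃.
no-rainbow-c : ∀ s n t q → length (edges (CP (t ∷ 0 ∷ q ∷ []))) ≡ 2 ^ suc (suc s) ∸ 1 →
               ¬ RainbowCopy (CP (t ∷ 0 ∷ q ∷ [])) (hostGraph (suc (suc s)) n)
no-rainbow-c s n t q size copy = by-parity (isOdd t) (isOdd q) size-parity relation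
  where
  open ThreeSpines s n t 0 q copy size
  s₀≢s₁ : spine 0F ≢ spine (sucF 0F)
  s₀≢s₁ ()
  s₁≢s₂ : spine (sucF 0F) ≢ spine (sucF (sucF 0F))
  s₁≢s₂ ()
  by-parity : ∀ p p′ → p xor (p′ xor false) ≡ true → (if p then a else 𝟘) ⊕ (b ⊕ (if p′ then c else 𝟘)) ≡ 𝟘 → ⊥
  by-parity true  false _ rel = s₀≢s₁ (labels-distinguish (⊕≡𝟘⇒≡ a b (trans (cong (a ⊕_) (sym (⊕-identityʳ b))) rel)))
  by-parity false true  _ rel = s₁≢s₂ (labels-distinguish (⊕≡𝟘⇒≡ b c (trans (sym (⊕-identityˡ (b ⊕ c))) rel)))
  by-parity true  true  () _
  by-parity false false () _

-- (d) CP(t,0,0,q): t + q is even; if both are even the relation identifies v₂ with v₃,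
-- if both are odd it gives L v₁ ⊕ L v₂ = L v₃ ⊕ L v₄, so edges v₁v₂ and v₃v₄ share a colour.
no-rainbow-d : ∀ s n t q → length (edges (CP (t ∷ 0 ∷ 0 ∷ q ∷ []))) ≡ 2 ^ suc (suc s) ∸ 1 →
               ¬ RainbowCopy (CP (t ∷ 0 ∷ 0 ∷ q ∷ [])) (hostGraph (suc (suc s)) n)
no-rainbow-d s n t q size copy = by-parity (isOdd t) (isOdd q) size-parity relation
  where
  open FourSpines s n t 0 0 q copy size
  s₁≢s₂ : spine (sucF 0F) ≢ spine (sucF (sucF 0F))
  s₁≢s₂ ()
  by-parity : ∀ p p′ → true xor (p xor (p′ xor false)) ≡ true →
              (if p then a else 𝟘) ⊕ (b ⊕ (c ⊕ (if p′ then d else 𝟘))) ≡ 𝟘 → ⊥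
  by-parity false false _ rel =
    s₁≢s₂ (labels-distinguish (⊕≡𝟘⇒≡ b c (trans (cong (b ⊕_) (sym (⊕-identityʳ c))) (trans (sym (⊕-identityˡ _)) rel))))
  by-parity true true _ rel =
    first≢third (proj₂ (proj₂ (proj₂ copy))) (cong fromBits (⊕≡𝟘⇒≡ (a ⊕ b) (c ⊕ d) (trans (⊕-assoc a b (c ⊕ d)) rel)))
  by-parity true  false () _
  by-parity false true  () _

-- (e) CP(t,1,q), t, q odd: the relation reads L v₁ ⊕ L v₃ = 𝟘.
no-rainbow-e : ∀ s n t q → Odd t → Odd q → length (edges (CP (t ∷ 1 ∷ q ∷ []))) ≡ 2 ^ suc (suc s) ∸ 1 →
               ¬ RainbowCopy (CP (t ∷ 1 ∷ q ∷ [])) (hostGraph (suc (suc s)) n)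
no-rainbow-e s n t q t-odd q-odd size copy = s₀≢s₂ (labels-distinguish (⊕≡𝟘⇒≡ a c a⊕c≡𝟘))
  where
  open ThreeSpines s n t 1 q copy size
  s₀≢s₂ : spine 0F ≢ spine (sucF (sucF 0F))
  s₀≢s₂ ()
  a⊕c≡𝟘 : a ⊕ c ≡ 𝟘
  a⊕c≡𝟘 = trans (cong (a ⊕_) (sym (⊕-identityˡ c)))
            (subst₂ (λ p p′ → (if p then a else 𝟘) ⊕ (𝟘 ⊕ (if p′ then c else 𝟘)) ≡ 𝟘) (odd⇒isOdd t-odd) (odd⇒isOdd q-odd) relation)

no-rainbow : ∀ s n σ → Shape σ → length (edges (CP σ)) ≡ 2 ^ suc (suc s) ∸ 1 →
             ¬ RainbowCopy (CP σ) (hostGraph (suc (suc s)) n)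
no-rainbow s n _ (shape-a t _)             = no-rainbow-a s n t
no-rainbow s n _ (shape-b t q _ _ to qo)   = no-rainbow-b s n t q to qo
no-rainbow s n _ (shape-c t q _ _)         = no-rainbow-c s n t q
no-rainbow s n _ (shape-d t q _ _)         = no-rainbow-d s n t q
no-rainbow s n _ (shape-e t q _ _ to qo)   = no-rainbow-e s n t q to qo

theorem4p3 : ∀ (s : ℕ) (σ : List ℕ) → 2 ≤ s → Shape σ →
    length (edges (CP σ)) ≡ 2 ^ s ∸ 1 →
    ∃ λ (C : ℕ) → ∃ λ (N : ℕ) → ∀ (n : ℕ) → N ≤ n →
      ∃ λ (G : ColoredGraph n) → Proper G × ¬ RainbowCopy (CP σ) G ×
        (2 ^ s ∸ 1) * n ≤ 2 * edgeCount G + C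
theorem4p3 (suc (suc s)) σ (s≤s (s≤s z≤n)) shape size =
  (2 ^ S ∸ 1) * 2 ^ S , 0 , λ n _ →
    hostGraph S n , hostGraph-proper S n , no-rainbow s n σ shape size , Counting.edge-bound S n
  where
  S = suc (suc s)
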